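{- Let $c_{n,m}$ be the number of increasing 1,2-trees with $n$ vertices and $m$ edges, and let $C(z,u) = \sum_{n \geq 1, m \geq 0} c_{n,m} \frac{z^n u^m}{n!}$ be their exponential generating function (vertices counted by $z$, edges by $u$). Then $C$ satisfies the partial differential equation \[ \frac{\partial C}{\partial z} = 1 + z u \frac{\partial C}{\partial z} + u^3 \frac{\partial C}{\partial u}, \] together with the initial condition $C(0,u)=0$.
   Context: Increasing 1,2-trees are labeled graphs defined inductively: the only increasing 1,2-tree with one vertex is the isolated vertex labeled $1$; given an increasing 1,2-tree $T$ with $n$ vertices (labeled $1,\dots,n$), one obtains an increasing 1,2-tree with $n+1$ vertices by choosing either a vertex of $T$ or an edge of $T$ and adding a new vertex labeled $n+1$ adjacent to the chosen vertex, respectively to both endpoints of the chosen edge. -}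

module Defs where

open import Data.Nat as ℕ using (ℕ; zero; suc; _!)
open import Data.Nat.Properties using (_!≢0)
open import Data.Integer using (+_)
open import Data.Rational using (ℚ; _/_; _+_; _*_; 0ℚ; 1ℚ)
open import Data.Fin using (Fin; inject₁; fromℕ)
open import Data.Fin.Subset using (Subset; ⁅_⁆; _∪_; _∈_; ∣_∣) renaming (⊥ to ∅)
open import Data.List using (List; length)
open import Data.List.Membership.Propositional renaming (_∈_ to _∈ₗ_)
open import Data.List.Relation.Unary.Unique.Propositional using (Unique)
open import Data.Product using (_×_; Σ)
open import Function.Bundles using (_⇔_)
open import Relation.Binary.PropositionalEquality using (_≡_)

-- Simple graphs on the vertex set {1,…,n}, represented as Fin n
-- (vertex with label k+1 is the element k : Fin n).  A graph on n+1
-- vertices is a graph on the first n vertices together with the set of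
-- (earlier) neighbours of the last vertex.  Every simple graph on Fin n
-- has exactly one such representation, so ≡ on Graph n is equality of
-- labelled graphs.

data Graph : ℕ → Set where
  []  : Graph 0
  _▷_ : ∀ {n} → Graph n → Subset n → Graph (suc n)

edges : ∀ {n} → Graph n → ℕ
edges []      = 0
edges (G ▷ S) = edges G ℕ.+ ∣ S ∣

-- Edge G i j : {i , j} is an edge of G, with i the smaller endpoint.
data Edge : ∀ {n} → Graph n → Fin n → Fin n → Set where
  new : ∀ {n} {G : Graph n} {S : Subset n} {i : Fin n} →
        i ∈ S → Edge (G ▷ S) (inject₁ i) (fromℕ n)
  old : ∀ {n} {G : Graph n} {S : Subset n} {i j : Fin n} →
        Edge G i j → Edge (G ▷ S) (inject₁ i) (inject₁ j)

data IncTree : ∀ {n} → Graph n → Set where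
  single : IncTree ([] ▷ ∅)
  addV   : ∀ {n} {G : Graph n} → IncTree G → (v : Fin n) →
           IncTree (G ▷ ⁅ v ⁆)
  addE   : ∀ {n} {G : Graph n} {i j : Fin n} → IncTree G → Edge G i j →
           IncTree (G ▷ (⁅ i ⁆ ∪ ⁅ j ⁆))

IsCount : ℕ → ℕ → ℕ → Set
IsCount n m k =
  Σ (List (Graph n)) λ L →
    Unique L × ((∀ G → (G ∈ₗ L) ⇔ (IncTree G × edges G ≡ m))) × length L ≡ k

-- Formal power series in two variables z, u with rational coefficients:
-- F i j is the coefficient of z^i u^j.

FPS : Set
FPS = ℕ → ℕ → ℚ

fromℕℚ : ℕ → ℚ
fromℕℚ k = (+ k) / 1

_⊕_ : FPS → FPS → FPS
(F ⊕ G) i j = F i j + G i j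

𝟙 : FPS
𝟙 zero    zero    = 1ℚ
𝟙 _       _       = 0ℚ

z·_ : FPS → FPS
(z· F) zero    j = 0ℚ
(z· F) (suc i) j = F i j

u·_ : FPS → FPS
(u· F) i zero    = 0ℚ
(u· F) i (suc j) = F i j

∂z : FPS → FPS
∂z F i j = fromℕℚ (suc i) * F (suc i) j

∂u : FPS → FPS
∂u F i j = fromℕℚ (suc j) * F i (suc j)

atZ0 : FPS → ℕ → ℚ
atZ0 F j = F 0 j

EGF : (ℕ → ℕ → ℕ) → FPS
EGF c zero    m = 0ℚ
EGF c (suc n) m = _/_ (+ c (suc n) m) (suc n !) {{suc n !≢0}}

-- An increasing 1,2-tree on n + 2 vertices is an increasing 1,2-tree on n + 1
-- vertices together with the attachment of its last vertex, either to one of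
-- the n + 1 earlier vertices (one new edge) or to both ends of one of its
-- edges (two new edges), and distinct choices give distinct graphs.  Hence
--   c (n + 2) m = (n + 1) c (n + 1) (m - 1) + (m - 2) c (n + 1) (m - 2),
-- and comparing the coefficients of z^n u^m on both sides of the PDE gives
-- back exactly this recurrence divided by n!, the term 1 coming from c 1 0 = 1.
module Submission where

open import Data.Bool using (true; false)
open import Data.Empty using (⊥-elim)
open import Data.Fin as Fin using (Fin; inject₁; fromℕ; _<_)
import Data.Fin.Properties as Finₚ
open import Data.Fin.Subset using (Subset; ⁅_⁆; _∪_; _∈_; ∣_∣) renaming (⊥ to ∅)
open import Data.Fin.Subset.Properties using (x∈⁅x⁆; x∈⁅y⁆⇒x≡y; ∣⁅x⁆∣≡1; x∈p∪q⁻; x∈p∪q⁺; ∪-identityˡ)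
import Data.Integer as ℤ
import Data.Integer.Properties as ℤₚ
open import Data.Integer.Tactic.RingSolver using (solve-∀)
open import Data.List using (List; []; _∷_; _++_; map; concatMap; length; allFin)
open import Data.List.Membership.Propositional using (find; lose) renaming (_∈_ to _∈ₗ_)
open import Data.List.Membership.Propositional.Properties
  using (∈-map⁺; ∈-map⁻; ∈-++⁺ˡ; ∈-++⁺ʳ; ∈-++⁻; ∈-allFin; ∈-concatMap⁺; ∈-concatMap⁻)
open import Data.List.Membership.Propositional.Properties.WithK using (unique∧set⇒bag)
open import Data.List.Properties using (length-++; length-map; length-tabulate)
open import Data.List.Relation.Binary.BagAndSetEquality using (∼bag⇒↭)
open import Data.List.Relation.Binary.Disjoint.Propositional using (Disjoint)
open import Data.List.Relation.Binary.Permutation.Propositional.Properties using (↭-length)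
import Data.List.Relation.Unary.All as All
import Data.List.Relation.Unary.All.Properties as Allₚ
open import Data.List.Relation.Unary.Any using (here; there)
open import Data.List.Relation.Unary.AllPairs using ([]; _∷_)
open import Data.List.Relation.Unary.Unique.Propositional using (Unique)
open import Data.List.Relation.Unary.Unique.Propositional.Properties
  using (++⁺; map⁺; allFin⁺; Unique[x∷xs]⇒x∉xs)
open import Data.Nat as ℕ using (ℕ; zero; suc; _+_; _*_; _!; NonZero)
import Data.Nat.Properties as ℕₚ
open import Data.Product as Product using (_×_; _,_; ∃; proj₁; proj₂)
open import Data.Rational as ℚ using (ℚ; 0ℚ; _/_; toℚᵘ)
import Data.Rational.Properties as ℚₚ
open import Data.Rational.Unnormalised as ℚᵘ using (mkℚᵘ; *≡*) renaming (_≃_ to _≃ᵘ_)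
import Data.Rational.Unnormalised.Properties as ℚᵘₚ
open import Data.Sum using (_⊎_; inj₁; inj₂)
open import Data.Vec using ([]; _∷_; here; there)
open import Function using (_∘_)
open import Function.Bundles using (_⇔_; mk⇔; Equivalence)
import Function.Properties.Equivalence as ⇔
open import Relation.Binary.PropositionalEquality

open import Defs

open Equivalence using (to; from)

Enumerates : {A : Set} → (A → Set) → List A → Set
Enumerates P xs = Unique xs × (∀ x → x ∈ₗ xs ⇔ P x)

module _ {A : Set} {P : A → Set} where

  enumerations-length-≡ : ∀ {xs ys} → Enumerates P xs → Enumerates P ys → length xs ≡ length ys
  enumerations-length-≡ (xs! , ∈xs⇔P) (ys! , ∈ys⇔P) =
    ↭-length (∼bag⇒↭ (unique∧set⇒bag xs! ys! λ {x} → ⇔.trans (∈xs⇔P x) (⇔.sym (∈ys⇔P x))))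

module _ {A B : Set} (f : A → List B) where

  ∈-concatMap⁻′ : ∀ {xs y} → y ∈ₗ concatMap f xs → ∃ λ x → x ∈ₗ xs × y ∈ₗ f x
  ∈-concatMap⁻′ = find ∘ ∈-concatMap⁻ f

  ∈-concatMap⁺′ : ∀ {xs x y} → x ∈ₗ xs → y ∈ₗ f x → y ∈ₗ concatMap f xs
  ∈-concatMap⁺′ x∈xs y∈fx = ∈-concatMap⁺ f (lose x∈xs y∈fx)

  length-concatMap-const : ∀ k xs → (∀ {x} → x ∈ₗ xs → length (f x) ≡ k) →
                           length (concatMap f xs) ≡ length xs * k
  length-concatMap-const k []       _  = refl
  length-concatMap-const k (x ∷ xs) ∣f∣≡k = begin
    length (f x ++ concatMap f xs)             ≡⟨ length-++ (f x) ⟩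
    length (f x) + length (concatMap f xs)     ≡⟨ cong₂ _+_ (∣f∣≡k (here refl))
                                                    (length-concatMap-const k xs (∣f∣≡k ∘ there)) ⟩
    k + length xs * k                          ∎
    where open ≡-Reasoning

  concatMap-unique : (parent : B → A) → (∀ {x y} → y ∈ₗ f x → parent y ≡ x) →
                     ∀ {xs} → Unique xs → (∀ x → Unique (f x)) → Unique (concatMap f xs)
  concatMap-unique parent parent-f {[]}     []             f! = []
  concatMap-unique parent parent-f {x ∷ xs} x∷xs!@(_ ∷ xs!) f! =
    ++⁺ (f! x) (concatMap-unique parent parent-f xs! f!) disjoint
    where
    disjoint : Disjoint (f x) (concatMap f xs)
    disjoint (y∈fx , y∈rest) with ∈-concatMap⁻′ y∈rest
    ... | x′ , x′∈xs , y∈fx′ =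
      Unique[x∷xs]⇒x∉xs x∷xs! (subst (_∈ₗ xs) (trans (sym (parent-f y∈fx′)) (parent-f y∈fx)) x′∈xs)

map-unique-on : {A B : Set} (f : A → B) → ∀ {xs} → Unique xs →
                (∀ {x y} → x ∈ₗ xs → y ∈ₗ xs → f x ≡ f y → x ≡ y) → Unique (map f xs)
map-unique-on f {[]}     []           _   = []
map-unique-on f {x ∷ xs} (x∉xs ∷ xs!) inj =
  Allₚ.map⁺ (All.tabulate λ y∈xs fx≡fy → All.lookup x∉xs y∈xs (inj (here refl) (there y∈xs) fx≡fy))
  ∷ map-unique-on f xs! (λ x∈ y∈ → inj (there x∈) (there y∈))

elements : ∀ {n} → Subset n → List (Fin n)
elements []          = []
elements (true  ∷ p) = Fin.zero ∷ map Fin.suc (elements p)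
elements (false ∷ p) = map Fin.suc (elements p)

length-elements : ∀ {n} (p : Subset n) → length (elements p) ≡ ∣ p ∣
length-elements []          = refl
length-elements (true  ∷ p) = cong suc (trans (length-map Fin.suc (elements p)) (length-elements p))
length-elements (false ∷ p) = trans (length-map Fin.suc (elements p)) (length-elements p)

elements-unique : ∀ {n} (p : Subset n) → Unique (elements p)
elements-unique []          = []
elements-unique (true  ∷ p) = Allₚ.map⁺ (All.tabulate λ _ ()) ∷ map⁺ Finₚ.suc-injective (elements-unique p)
elements-unique (false ∷ p) = map⁺ Finₚ.suc-injective (elements-unique p)

∈-elements⁻ : ∀ {n} (p : Subset n) {i} → i ∈ₗ elements p → i ∈ p
∈-elements⁻ (true ∷ p) (here refl) = here
∈-elements⁻ (true ∷ p) (there i∈) with ∈-map⁻ Fin.suc i∈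
... | j , j∈ , refl = there (∈-elements⁻ p j∈)
∈-elements⁻ (false ∷ p) i∈ with ∈-map⁻ Fin.suc i∈
... | j , j∈ , refl = there (∈-elements⁻ p j∈)

∈-elements⁺ : ∀ {n} (p : Subset n) {i} → i ∈ p → i ∈ₗ elements p
∈-elements⁺ (true  ∷ p) here       = here refl
∈-elements⁺ (true  ∷ p) (there i∈) = there (∈-map⁺ Fin.suc (∈-elements⁺ p i∈))
∈-elements⁺ (false ∷ p) (there i∈) = ∈-map⁺ Fin.suc (∈-elements⁺ p i∈)

⁅⁆-injective : ∀ {n} {i j : Fin n} → ⁅ i ⁆ ≡ ⁅ j ⁆ → i ≡ j
⁅⁆-injective {i = i} {j} eq = x∈⁅y⁆⇒x≡y j (subst (i ∈_) eq (x∈⁅x⁆ i))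

∈⁅⁆∪⁅⁆⁻ : ∀ {n} {x i j : Fin n} → x ∈ ⁅ i ⁆ ∪ ⁅ j ⁆ → x ≡ i ⊎ x ≡ j
∈⁅⁆∪⁅⁆⁻ {i = i} {j} x∈ with x∈p∪q⁻ ⁅ i ⁆ ⁅ j ⁆ x∈
... | inj₁ x∈⁅i⁆ = inj₁ (x∈⁅y⁆⇒x≡y i x∈⁅i⁆)
... | inj₂ x∈⁅j⁆ = inj₂ (x∈⁅y⁆⇒x≡y j x∈⁅j⁆)

∣⁅i⁆∪⁅j⁆∣≡2 : ∀ {n} {i j : Fin n} → i < j → ∣ ⁅ i ⁆ ∪ ⁅ j ⁆ ∣ ≡ 2
∣⁅i⁆∪⁅j⁆∣≡2 {i = Fin.zero}  {Fin.suc j} _          = cong suc (trans (cong ∣_∣ (∪-identityˡ ⁅ j ⁆)) (∣⁅x⁆∣≡1 j))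
∣⁅i⁆∪⁅j⁆∣≡2 {i = Fin.suc i} {Fin.suc j} (ℕ.s≤s i<j) = ∣⁅i⁆∪⁅j⁆∣≡2 i<j

⁅⁆∪⁅⁆-injective : ∀ {n} {i j i′ j′ : Fin n} → i < j → i′ < j′ →
                  ⁅ i ⁆ ∪ ⁅ j ⁆ ≡ ⁅ i′ ⁆ ∪ ⁅ j′ ⁆ → i ≡ i′ × j ≡ j′
⁅⁆∪⁅⁆-injective {i = i} {j} {i′} {j′} i<j i′<j′ eq
  with ∈⁅⁆∪⁅⁆⁻ (subst (i ∈_) eq (x∈p∪q⁺ (inj₁ (x∈⁅x⁆ i))))
     | ∈⁅⁆∪⁅⁆⁻ (subst (j ∈_) eq (x∈p∪q⁺ (inj₂ (x∈⁅x⁆ j))))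
     | ∈⁅⁆∪⁅⁆⁻ (subst (i′ ∈_) (sym eq) (x∈p∪q⁺ (inj₁ (x∈⁅x⁆ i′))))
... | inj₁ refl | inj₂ refl | _         = refl , refl
... | inj₁ refl | inj₁ refl | _         = ⊥-elim (ℕₚ.<-irrefl refl i<j)
... | inj₂ refl | _         | inj₁ refl = ⊥-elim (ℕₚ.<-irrefl refl i′<j′)
... | inj₂ refl | _         | inj₂ refl = ⊥-elim (ℕₚ.<-asym i<j i′<j′)

oldPair : ∀ {n} → Fin n × Fin n → Fin (suc n) × Fin (suc n)
oldPair = Product.map inject₁ inject₁

newPair : ∀ {n} → Fin n → Fin (suc n) × Fin (suc n)
newPair {n} i = inject₁ i , fromℕ n

edgeList : ∀ {n} → Graph n → List (Fin n × Fin n)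
edgeList []      = []
edgeList (G ▷ S) = map oldPair (edgeList G) ++ map newPair (elements S)

length-edgeList : ∀ {n} (G : Graph n) → length (edgeList G) ≡ edges G
length-edgeList []      = refl
length-edgeList (G ▷ S) = begin
  length (map oldPair (edgeList G) ++ map newPair (elements S))  ≡⟨ length-++ (map oldPair (edgeList G)) ⟩
  length (map oldPair (edgeList G)) + length (map newPair (elements S))
    ≡⟨ cong₂ _+_ (trans (length-map oldPair (edgeList G)) (length-edgeList G))
                 (trans (length-map newPair (elements S)) (length-elements S)) ⟩
  edges G + ∣ S ∣                                              ∎
  where open ≡-Reasoning

∈-edgeList⁻ : ∀ {n} (G : Graph n) {i j} → (i , j) ∈ₗ edgeList G → Edge G i j
∈-edgeList⁻ (G ▷ S) ij∈ with ∈-++⁻ (map oldPair (edgeList G)) ij∈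
... | inj₁ ∈old with ∈-map⁻ oldPair ∈old
...   | _ , ∈G , refl = old (∈-edgeList⁻ G ∈G)
∈-edgeList⁻ (G ▷ S) ij∈ | inj₂ ∈new with ∈-map⁻ newPair ∈new
...   | _ , ∈S , refl = new (∈-elements⁻ S ∈S)

∈-edgeList⁺ : ∀ {n} {G : Graph n} {i j} → Edge G i j → (i , j) ∈ₗ edgeList G
∈-edgeList⁺ {G = G ▷ S} (new i∈S) = ∈-++⁺ʳ (map oldPair (edgeList G)) (∈-map⁺ newPair (∈-elements⁺ S i∈S))
∈-edgeList⁺ {G = G ▷ S} (old e)   = ∈-++⁺ˡ (∈-map⁺ oldPair (∈-edgeList⁺ e))

edgeList-unique : ∀ {n} (G : Graph n) → Unique (edgeList G)
edgeList-unique []      = []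
edgeList-unique (G ▷ S) =
  ++⁺ (map⁺ oldPair-injective (edgeList-unique G)) (map⁺ newPair-injective (elements-unique S)) disjoint
  where
  oldPair-injective : ∀ {p q} → oldPair p ≡ oldPair q → p ≡ q
  oldPair-injective {_ , _} {_ , _} eq =
    cong₂ _,_ (Finₚ.inject₁-injective (cong proj₁ eq)) (Finₚ.inject₁-injective (cong proj₂ eq))
  newPair-injective : ∀ {i j} → newPair i ≡ newPair j → i ≡ j
  newPair-injective eq = Finₚ.inject₁-injective (cong proj₁ eq)
  disjoint : Disjoint (map oldPair (edgeList G)) (map newPair (elements S))
  disjoint (∈old , ∈new) with ∈-map⁻ oldPair ∈old | ∈-map⁻ newPair ∈new
  ... | _ , _ , refl | _ , _ , eq = Finₚ.fromℕ≢inject₁ (sym (cong proj₂ eq))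

Edge⇒< : ∀ {n} {G : Graph n} {i j} → Edge G i j → i < j
Edge⇒< {suc n} (new {i = i} _) rewrite Finₚ.toℕ-inject₁ i | Finₚ.toℕ-fromℕ n = Finₚ.toℕ<n i
Edge⇒< (old {i = i} {j} e) rewrite Finₚ.toℕ-inject₁ i | Finₚ.toℕ-inject₁ j = Edge⇒< e

-- Growing a tree by one vertex

IncTreeWith : ∀ {n} → ℕ → Graph n → Set
IncTreeWith m G = IncTree G × edges G ≡ m

init : ∀ {n} → Graph (suc n) → Graph n
init (G ▷ _) = G

lastDegree : ∀ {n} → Graph (suc n) → ℕ
lastDegree (_ ▷ S) = ∣ S ∣

▷-injectiveʳ : ∀ {n} {G G′ : Graph n} {S S′} → G ▷ S ≡ G′ ▷ S′ → S ≡ S′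
▷-injectiveʳ refl = refl

edgeSet : ∀ {n} → Fin n × Fin n → Subset n
edgeSet (i , j) = ⁅ i ⁆ ∪ ⁅ j ⁆

module Extension {n : ℕ} (trees : ℕ → List (Graph (suc n)))
                 (trees-enumerate : ∀ m → Enumerates (IncTreeWith m) (trees m)) where

  vertexChildren : Graph (suc n) → List (Graph (suc (suc n)))
  vertexChildren G = map (λ v → G ▷ ⁅ v ⁆) (allFin (suc n))

  edgeChildren : Graph (suc n) → List (Graph (suc (suc n)))
  edgeChildren G = map (λ e → G ▷ edgeSet e) (edgeList G)

  viaVertex : ℕ → List (Graph (suc (suc n)))
  viaVertex zero    = []
  viaVertex (suc m) = concatMap vertexChildren (trees m)

  viaEdge : ℕ → List (Graph (suc (suc n)))
  viaEdge (suc (suc m)) = concatMap edgeChildren (trees m)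
  viaEdge _             = []

  children : ℕ → List (Graph (suc (suc n)))
  children m = viaVertex m ++ viaEdge m

  ∈-trees⁻ : ∀ {m G} → G ∈ₗ trees m → IncTreeWith m G
  ∈-trees⁻ {m} {G} = to (proj₂ (trees-enumerate m) G)

  ∈-trees⁺ : ∀ {G} → IncTree G → G ∈ₗ trees (edges G)
  ∈-trees⁺ {G} t = from (proj₂ (trees-enumerate (edges G)) G) (t , refl)

  viaVertex-sound : ∀ m {y} → y ∈ₗ viaVertex m → IncTreeWith m y × lastDegree y ≡ 1
  viaVertex-sound (suc m) y∈ with ∈-concatMap⁻′ vertexChildren y∈
  ... | G , G∈ , y∈G with ∈-map⁻ (λ v → G ▷ ⁅ v ⁆) {xs = allFin (suc n)} y∈G | ∈-trees⁻ G∈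
  ...   | v , _ , refl | t , refl =
    (addV t v , trans (cong (edges G +_) (∣⁅x⁆∣≡1 v)) (ℕₚ.+-comm (edges G) 1)) , ∣⁅x⁆∣≡1 v

  viaEdge-sound : ∀ m {y} → y ∈ₗ viaEdge m → IncTreeWith m y × lastDegree y ≡ 2
  viaEdge-sound (suc (suc m)) y∈ with ∈-concatMap⁻′ edgeChildren y∈
  ... | G , G∈ , y∈G with ∈-map⁻ (λ e → G ▷ edgeSet e) y∈G | ∈-trees⁻ G∈
  ...   | (i , j) , ij∈ , refl | t , refl =
    (addE t e , trans (cong (edges G +_) ∣S∣≡2) (ℕₚ.+-comm (edges G) 2)) , ∣S∣≡2
    where
    e = ∈-edgeList⁻ G ij∈
    ∣S∣≡2 = ∣⁅i⁆∪⁅j⁆∣≡2 (Edge⇒< e)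

  children-complete : ∀ {y} → IncTree y → y ∈ₗ children (edges y)
  children-complete (addV {G = G} t v) rewrite ∣⁅x⁆∣≡1 v | ℕₚ.+-comm (edges G) 1 =
    ∈-++⁺ˡ (∈-concatMap⁺′ vertexChildren (∈-trees⁺ t) (∈-map⁺ (λ v → G ▷ ⁅ v ⁆) (∈-allFin v)))
  children-complete (addE {G = G} t e) rewrite ∣⁅i⁆∪⁅j⁆∣≡2 (Edge⇒< e) | ℕₚ.+-comm (edges G) 2 =
    ∈-++⁺ʳ (viaVertex (suc (suc (edges G))))
      (∈-concatMap⁺′ edgeChildren (∈-trees⁺ t) (∈-map⁺ (λ e → G ▷ edgeSet e) (∈-edgeList⁺ e)))

  viaVertex-unique : ∀ m → Unique (viaVertex m)
  viaVertex-unique zero    = []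
  viaVertex-unique (suc m) =
    concatMap-unique vertexChildren init init-vertexChild (proj₁ (trees-enumerate m)) λ _ →
      map⁺ (λ eq → ⁅⁆-injective (▷-injectiveʳ eq)) (allFin⁺ (suc n))
    where
    init-vertexChild : ∀ {G y} → y ∈ₗ vertexChildren G → init y ≡ G
    init-vertexChild {G} y∈ with ∈-map⁻ (λ v → G ▷ ⁅ v ⁆) {xs = allFin (suc n)} y∈
    ... | _ , _ , refl = refl

  viaEdge-unique : ∀ m → Unique (viaEdge m)
  viaEdge-unique (suc (suc m)) =
    concatMap-unique edgeChildren init init-edgeChild (proj₁ (trees-enumerate m)) λ G →
      map-unique-on (λ e → G ▷ edgeSet e) (edgeList-unique G) (edgeSet-injective G)
    where
    init-edgeChild : ∀ {G y} → y ∈ₗ edgeChildren G → init y ≡ G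
    init-edgeChild {G} y∈ with ∈-map⁻ (λ e → G ▷ edgeSet e) y∈
    ... | _ , _ , refl = refl
    edgeSet-injective : ∀ G {e e′} → e ∈ₗ edgeList G → e′ ∈ₗ edgeList G →
                        G ▷ edgeSet e ≡ G ▷ edgeSet e′ → e ≡ e′
    edgeSet-injective G {_ , _} {_ , _} e∈ e′∈ eq
      with ⁅⁆∪⁅⁆-injective (Edge⇒< (∈-edgeList⁻ G e∈)) (Edge⇒< (∈-edgeList⁻ G e′∈)) (▷-injectiveʳ eq)
    ... | refl , refl = refl
  viaEdge-unique (suc zero) = []
  viaEdge-unique zero       = []

  children-enumerate : ∀ m → Enumerates (IncTreeWith m) (children m)
  children-enumerate m = ++⁺ (viaVertex-unique m) (viaEdge-unique m) disjoint , λ y → mk⇔ sound complete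
    where
    disjoint : Disjoint (viaVertex m) (viaEdge m)
    disjoint (∈V , ∈E) with trans (sym (proj₂ (viaVertex-sound m ∈V))) (proj₂ (viaEdge-sound m ∈E))
    ... | ()
    sound : ∀ {y} → y ∈ₗ children m → IncTreeWith m y
    sound y∈ with ∈-++⁻ (viaVertex m) y∈
    ... | inj₁ ∈V = proj₁ (viaVertex-sound m ∈V)
    ... | inj₂ ∈E = proj₁ (viaEdge-sound m ∈E)
    complete : ∀ {y} → IncTreeWith m y → y ∈ₗ children m
    complete (t , refl) = children-complete t

  length-viaVertex : ∀ m → length (viaVertex (suc m)) ≡ length (trees m) * suc n
  length-viaVertex m = length-concatMap-const vertexChildren (suc n) (trees m) λ {G} _ →
    trans (length-map (λ v → G ▷ ⁅ v ⁆) (allFin (suc n))) (length-tabulate {n = suc n} (λ i → i))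

  length-viaEdge : ∀ m → length (viaEdge (suc (suc m))) ≡ length (trees m) * m
  length-viaEdge m = length-concatMap-const edgeChildren m (trees m) λ {G} G∈ →
    trans (length-map (λ e → G ▷ edgeSet e) (edgeList G)) (trans (length-edgeList G) (proj₂ (∈-trees⁻ G∈)))

-- The counting recurrence

record IncTreeRecurrence (c : ℕ → ℕ → ℕ) : Set where
  field
    single-vertex          : c 1 0 ≡ 1
    single-vertex-edgeless : ∀ m → c 1 (suc m) ≡ 0
    no-edges               : ∀ n → c (2 + n) 0 ≡ 0
    one-edge               : ∀ n → c (2 + n) 1 ≡ suc n * c (suc n) 0
    more-edges             : ∀ n m → c (2 + n) (2 + m) ≡ suc n * c (suc n) (suc m) + m * c (suc n) m

singleVertexTrees : ℕ → List (Graph 1)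
singleVertexTrees zero    = ([] ▷ ∅) ∷ []
singleVertexTrees (suc m) = []

singleVertexTrees-enumerate : ∀ m → Enumerates (IncTreeWith m) (singleVertexTrees m)
singleVertexTrees-enumerate m = unique m , λ G → mk⇔ (sound m) (complete m)
  where
  unique : ∀ m → Unique (singleVertexTrees m)
  unique zero    = All.[] ∷ []
  unique (suc m) = []
  sound : ∀ m {G} → G ∈ₗ singleVertexTrees m → IncTreeWith m G
  sound zero (here refl) = single , refl
  complete : ∀ m {G} → IncTreeWith m G → G ∈ₗ singleVertexTrees m
  complete _ (single , refl) = here refl
  complete _ (addV _ () , _)
  complete _ (addE _ () , _)

counts-recurrence : (c : ℕ → ℕ → ℕ) → (∀ n m → IsCount (suc n) m (c (suc n) m)) → IncTreeRecurrence c
counts-recurrence c counts = record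
  { single-vertex          = count-≡ 0 0 (singleVertexTrees-enumerate 0)
  ; single-vertex-edgeless = λ m → count-≡ 0 (suc m) (singleVertexTrees-enumerate (suc m))
  ; no-edges               = λ n → count-≡ (suc n) 0 (children-enumerate n 0)
  ; one-edge               = one-edge
  ; more-edges             = more-edges
  }
  where
  trees : ∀ n → ℕ → List (Graph (suc n))
  trees n m = proj₁ (counts n m)

  length-trees : ∀ n m → length (trees n m) ≡ c (suc n) m
  length-trees n m = proj₂ (proj₂ (proj₂ (counts n m)))

  trees-enumerate : ∀ n m → Enumerates (IncTreeWith m) (trees n m)
  trees-enumerate n m = Product.map₂ proj₁ (proj₂ (counts n m))

  count-≡ : ∀ n m {xs} → Enumerates (IncTreeWith m) xs → c (suc n) m ≡ length xs
  count-≡ n m = trans (sym (length-trees n m)) ∘ enumerations-length-≡ (trees-enumerate n m)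

  open module Extensionₙ (n : ℕ) = Extension (trees n) (trees-enumerate n)

  count-children : ∀ n m → c (2 + n) m ≡ length (viaVertex n m) + length (viaEdge n m)
  count-children n m = trans (count-≡ (suc n) m (children-enumerate n m)) (length-++ (viaVertex n m))

  viaVertex-count : ∀ n m → length (viaVertex n (suc m)) ≡ suc n * c (suc n) m
  viaVertex-count n m = trans (length-viaVertex n m) (trans (cong (_* suc n) (length-trees n m)) (ℕₚ.*-comm _ (suc n)))

  viaEdge-count : ∀ n m → length (viaEdge n (2 + m)) ≡ m * c (suc n) m
  viaEdge-count n m = trans (length-viaEdge n m) (trans (cong (_* m) (length-trees n m)) (ℕₚ.*-comm _ m))

  one-edge : ∀ n → c (2 + n) 1 ≡ suc n * c (suc n) 0
  one-edge n = trans (count-children n 1) (trans (ℕₚ.+-identityʳ _) (viaVertex-count n 0))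

  more-edges : ∀ n m → c (2 + n) (2 + m) ≡ suc n * c (suc n) (suc m) + m * c (suc n) m
  more-edges n m = trans (count-children n (2 + m)) (cong₂ _+_ (viaVertex-count n (suc m)) (viaEdge-count n m))

toℚᵘ-/ : ∀ a d .{{_ : NonZero d}} → toℚᵘ (ℤ.+ a / d) ≃ᵘ (ℤ.+ a ℚᵘ./ d)
toℚᵘ-/ a (suc d) = ℚₚ.toℚᵘ-fromℚᵘ (mkℚᵘ (ℤ.+ a) d)

fromℕ-*-/ : ∀ x a d .{{_ : NonZero d}} → fromℕℚ x ℚ.* (ℤ.+ a / d) ≡ ℤ.+ (x * a) / d
fromℕ-*-/ x a d@(suc _) = ℚₚ.toℚᵘ-injective (begin
  toℚᵘ (fromℕℚ x ℚ.* (ℤ.+ a / d))             ≈⟨ ℚₚ.toℚᵘ-homo-* (fromℕℚ x) (ℤ.+ a / d) ⟩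
  toℚᵘ (fromℕℚ x) ℚᵘ.* toℚᵘ (ℤ.+ a / d)        ≈⟨ ℚᵘₚ.*-cong (toℚᵘ-/ x 1) (toℚᵘ-/ a d) ⟩
  (ℤ.+ x ℚᵘ./ 1) ℚᵘ.* (ℤ.+ a ℚᵘ./ d)          ≈⟨ *≡* (cong₂ ℤ._*_ (sym (ℤₚ.pos-* x a)) (cong ℤ.+_ (sym (ℕₚ.*-identityˡ d)))) ⟩
  ℤ.+ (x * a) ℚᵘ./ d                         ≈⟨ toℚᵘ-/ (x * a) d ⟨
  toℚᵘ (ℤ.+ (x * a) / d)                      ∎)
  where open ℚᵘₚ.≃-Reasoning

/-+-/ : ∀ a b d .{{_ : NonZero d}} → (ℤ.+ a / d) ℚ.+ (ℤ.+ b / d) ≡ ℤ.+ (a + b) / d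
/-+-/ a b d@(suc _) = ℚₚ.toℚᵘ-injective (begin
  toℚᵘ ((ℤ.+ a / d) ℚ.+ (ℤ.+ b / d))           ≈⟨ ℚₚ.toℚᵘ-homo-+ (ℤ.+ a / d) (ℤ.+ b / d) ⟩
  toℚᵘ (ℤ.+ a / d) ℚᵘ.+ toℚᵘ (ℤ.+ b / d)       ≈⟨ ℚᵘₚ.+-cong (toℚᵘ-/ a d) (toℚᵘ-/ b d) ⟩
  (ℤ.+ a ℚᵘ./ d) ℚᵘ.+ (ℤ.+ b ℚᵘ./ d)          ≈⟨ *≡* (trans (common-denominator (ℤ.+ a) (ℤ.+ b) (ℤ.+ d))
                                                           (cong (ℤ._* (ℤ.+ d ℤ.* ℤ.+ d)) (sym (ℤₚ.pos-+ a b)))) ⟩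
  ℤ.+ (a + b) ℚᵘ./ d                         ≈⟨ toℚᵘ-/ (a + b) d ⟨
  toℚᵘ (ℤ.+ (a + b) / d)                      ∎)
  where
  open ℚᵘₚ.≃-Reasoning
  common-denominator : ∀ A B D → (A ℤ.* D ℤ.+ B ℤ.* D) ℤ.* D ≡ (A ℤ.+ B) ℤ.* (D ℤ.* D)
  common-denominator = solve-∀

fromℕ-*-/-cancel : ∀ x a d .{{_ : NonZero d}} .{{_ : NonZero (suc x * d)}} → fromℕℚ (suc x) ℚ.* (ℤ.+ a / (suc x * d)) ≡ ℤ.+ a / d
fromℕ-*-/-cancel x a d@(suc _) = ℚₚ.toℚᵘ-injective (begin
  toℚᵘ (fromℕℚ (suc x) ℚ.* (ℤ.+ a / (suc x * d)))       ≈⟨ ℚₚ.toℚᵘ-homo-* (fromℕℚ (suc x)) (ℤ.+ a / (suc x * d)) ⟩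
  toℚᵘ (fromℕℚ (suc x)) ℚᵘ.* toℚᵘ (ℤ.+ a / (suc x * d))  ≈⟨ ℚᵘₚ.*-cong (toℚᵘ-/ (suc x) 1) (toℚᵘ-/ a (suc x * d)) ⟩
  (ℤ.+ suc x ℚᵘ./ 1) ℚᵘ.* (ℤ.+ a ℚᵘ./ (suc x * d))      ≈⟨ *≡* (trans (cancel (ℤ.+ suc x) (ℤ.+ a) (ℤ.+ d))
                                                                  (cong (λ k → ℤ.+ a ℤ.* ℤ.+ k) (sym (ℕₚ.*-identityˡ (suc x * d))))) ⟩
  ℤ.+ a ℚᵘ./ d                                         ≈⟨ toℚᵘ-/ a d ⟨
  toℚᵘ (ℤ.+ a / d)                                      ∎)
  where
  open ℚᵘₚ.≃-Reasoning
  cancel : ∀ X A D → (X ℤ.* A) ℤ.* D ≡ A ℤ.* (X ℤ.* D)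
  cancel = solve-∀

-- From the recurrence to the PDE

_/!_ : ℕ → ℕ → ℚ
a /! i = _/_ (ℤ.+ a) (i !) {{i ℕₚ.!≢0}}

module _ {c : ℕ → ℕ → ℕ} (recurrence : IncTreeRecurrence c) where
  open IncTreeRecurrence recurrence

  ∂z-EGF : ∀ i j → ∂z (EGF c) i j ≡ c (suc i) j /! i
  ∂z-EGF i j = fromℕ-*-/-cancel i (c (suc i) j) (i !) {{i ℕₚ.!≢0}} {{suc i ℕₚ.!≢0}}

  u³∂u-EGF-at-z⁰ : ∀ j → (u· (u· (u· ∂u (EGF c)))) 0 j ≡ 0ℚ
  u³∂u-EGF-at-z⁰ (suc (suc (suc j))) = ℚₚ.*-zeroʳ (fromℕℚ (suc j))
  u³∂u-EGF-at-z⁰ (suc (suc zero))    = refl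
  u³∂u-EGF-at-z⁰ (suc zero)          = refl
  u³∂u-EGF-at-z⁰ zero                = refl

  u³∂u-EGF : ∀ k j → (u· (u· (u· ∂u (EGF c)))) (suc k) (2 + j) ≡ fromℕℚ j ℚ.* (c (suc k) j /! suc k)
  u³∂u-EGF k zero    = sym (ℚₚ.*-zeroˡ (c (suc k) 0 /! suc k))
  u³∂u-EGF k (suc j) = refl

  EGF-pde : ∀ i j → ∂z (EGF c) i j ≡ (𝟙 ⊕ ((z· (u· ∂z (EGF c))) ⊕ (u· (u· (u· ∂u (EGF c)))))) i j
  EGF-pde zero zero = trans (∂z-EGF 0 0) (cong (_/! 0) single-vertex)
  EGF-pde zero (suc j) = begin
    ∂z (EGF c) 0 (suc j)                                 ≡⟨ ∂z-EGF 0 (suc j) ⟩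
    c 1 (suc j) /! 0                                     ≡⟨ cong (_/! 0) (single-vertex-edgeless j) ⟩
    0ℚ                                                   ≡⟨ cong (λ q → 0ℚ ℚ.+ (0ℚ ℚ.+ q)) (u³∂u-EGF-at-z⁰ (suc j)) ⟨
    0ℚ ℚ.+ (0ℚ ℚ.+ (u· (u· (u· ∂u (EGF c)))) 0 (suc j)) ∎
    where open ≡-Reasoning
  EGF-pde (suc k) zero = begin
    ∂z (EGF c) (suc k) 0  ≡⟨ ∂z-EGF (suc k) 0 ⟩
    c (2 + k) 0 /! suc k  ≡⟨ cong (_/! suc k) (no-edges k) ⟩
    0 /! suc k            ≡⟨ ℚₚ.0/n≡0 (suc k !) {{suc k ℕₚ.!≢0}} ⟩
    0ℚ ℚ.+ (0ℚ ℚ.+ 0ℚ)    ∎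
    where open ≡-Reasoning
  EGF-pde (suc k) (suc zero) = begin
    ∂z (EGF c) (suc k) 1                  ≡⟨ ∂z-EGF (suc k) 1 ⟩
    c (2 + k) 1 /! suc k                  ≡⟨ cong (_/! suc k) (one-edge k) ⟩
    (suc k * c (suc k) 0) /! suc k        ≡⟨ fromℕ-*-/ (suc k) (c (suc k) 0) (suc k !) {{suc k ℕₚ.!≢0}} ⟨
    ∂z (EGF c) k 0                        ≡⟨ trans (ℚₚ.+-identityˡ _) (ℚₚ.+-identityʳ _) ⟨
    0ℚ ℚ.+ (∂z (EGF c) k 0 ℚ.+ 0ℚ)        ∎
    where open ≡-Reasoning
  EGF-pde (suc k) (suc (suc j)) = begin
    ∂z (EGF c) (suc k) (2 + j)                             ≡⟨ ∂z-EGF (suc k) (2 + j) ⟩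
    c (2 + k) (2 + j) /! suc k                             ≡⟨ cong (_/! suc k) (more-edges k j) ⟩
    (suc k * c (suc k) (suc j) + j * c (suc k) j) /! suc k ≡⟨ /-+-/ (suc k * c (suc k) (suc j)) (j * c (suc k) j) (suc k !) {{suc k ℕₚ.!≢0}} ⟨
    (suc k * c (suc k) (suc j)) /! suc k ℚ.+ (j * c (suc k) j) /! suc k
      ≡⟨ cong₂ ℚ._+_ (fromℕ-*-/ (suc k) (c (suc k) (suc j)) (suc k !) {{suc k ℕₚ.!≢0}})
                     (fromℕ-*-/ j (c (suc k) j) (suc k !) {{suc k ℕₚ.!≢0}}) ⟨
    ∂z (EGF c) k (suc j) ℚ.+ fromℕℚ j ℚ.* (c (suc k) j /! suc k)
      ≡⟨ cong (∂z (EGF c) k (suc j) ℚ.+_) (u³∂u-EGF k j) ⟨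
    ∂z (EGF c) k (suc j) ℚ.+ (u· (u· (u· ∂u (EGF c)))) (suc k) (2 + j)
      ≡⟨ ℚₚ.+-identityˡ _ ⟨
    0ℚ ℚ.+ (∂z (EGF c) k (suc j) ℚ.+ (u· (u· (u· ∂u (EGF c)))) (suc k) (2 + j)) ∎
    where open ≡-Reasoning

lemma1 : (c : ℕ → ℕ → ℕ) →
         (∀ n m → IsCount (suc n) m (c (suc n) m)) →
         (∀ i j → ∂z (EGF c) i j ≡ (𝟙 ⊕ ((z· (u· ∂z (EGF c))) ⊕ (u· (u· (u· ∂u (EGF c)))))) i j)
         × (∀ j → atZ0 (EGF c) j ≡ 0ℚ)
lemma1 c counts = EGF-pde (counts-recurrence c counts) , λ _ → refl
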